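{- Let $G$ be a simple, strongly connected and balanced directed graph on vertex set $\{1,\dots,n\}$, and let $R=[r_{ij}]$ be its resistance matrix. Then every off-diagonal entry of $R$ is positive (so $R$ is a non-negative matrix), and $r_{ik}\le r_{ij}+r_{jk}$ for all vertices $i,j,k$.
   Context: For a simple directed graph $G=(V,E)$ with $V=\{1,\dots,n\}$, the adjacency matrix is $A=[a_{ij}]$ with $a_{ij}=1$ if $(i,j)\in E$ (a directed edge from $i$ to $j$) and $0$ otherwise. $G$ is balanced if for every vertex the indegree (column sum of $A$) equals the outdegree (row sum of $A$); it is strongly connected if every ordered pair of vertices is joined by a directed path. The Laplacian is $L=\operatorname{Diag}(A\mathbf{1})-A$, where $\mathbf{1}$ is the all-ones vector. With $L^\dagger=[l^\dagger_{ij}]$ the Moore–Penrose inverse of $L$, the resistance between $i$ and $j$ is $r_{ij}=l^\dagger_{ii}+l^\dagger_{jj}-2l^\dagger_{ij}$, and $R=[r_{ij}]$ is the resistance matrix. -}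

module Defs where

open import Data.Nat using (ℕ; zero; suc) renaming (_+_ to _+ℕ_)
open import Data.Bool using (Bool; true; false; if_then_else_)
open import Data.Fin using (Fin; zero; suc; _≟_)
open import Data.Rational using (ℚ; 0ℚ; 1ℚ; _+_; _-_; _*_)
open import Relation.Nullary using (does)
open import Relation.Binary.PropositionalEquality using (_≡_)
open import Relation.Binary.Construct.Closure.ReflexiveTransitive using (Star)

Digraph : ℕ → Set
Digraph n = Fin n → Fin n → Bool

Matrix : ℕ → Set
Matrix n = Fin n → Fin n → ℚ

∑ : (n : ℕ) → (Fin n → ℚ) → ℚ
∑ zero    f = 0ℚ
∑ (suc n) f = f zero + ∑ n (λ i → f (suc i))

count : (n : ℕ) → (Fin n → Bool) → ℕ
count zero    f = zero
count (suc n) f = (if f zero then suc zero else zero) +ℕ count n (λ i → f (suc i))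

adjMatrix : {n : ℕ} → Digraph n → Matrix n
adjMatrix G i j = if G i j then 1ℚ else 0ℚ

outdeg indeg : {n : ℕ} → Digraph n → Fin n → ℕ
outdeg {n} G i = count n (λ j → G i j)
indeg  {n} G j = count n (λ i → G i j)

-- simple: no loops (adjacency is 0/1 so no multiple edges)
Simple : {n : ℕ} → Digraph n → Set
Simple G = ∀ i → G i i ≡ false

Balanced : {n : ℕ} → Digraph n → Set
Balanced G = ∀ i → indeg G i ≡ outdeg G i

Edge : {n : ℕ} → Digraph n → Fin n → Fin n → Set
Edge G i j = G i j ≡ true

StronglyConnected : {n : ℕ} → Digraph n → Set
StronglyConnected G = ∀ i j → Star (Edge G) i j

_⊗_ : {n : ℕ} → Matrix n → Matrix n → Matrix n
_⊗_ {n} M N i j = ∑ n (λ k → M i k * N k j)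

transpose : {n : ℕ} → Matrix n → Matrix n
transpose M i j = M j i

rowSumDiag : {n : ℕ} → Matrix n → Matrix n
rowSumDiag {n} A i j = if does (i ≟ j) then ∑ n (λ k → A i k) else 0ℚ

laplacian : {n : ℕ} → Digraph n → Matrix n
laplacian G i j = rowSumDiag (adjMatrix G) i j - adjMatrix G i j

-- X is the Moore–Penrose inverse of M (the four Penrose equations;
-- the MP inverse of a rational matrix exists, is unique and is rational)
record IsMoorePenroseInverse {n : ℕ} (M X : Matrix n) : Set where
  field
    p1 : ∀ i j → (M ⊗ (X ⊗ M)) i j ≡ M i j
    p2 : ∀ i j → (X ⊗ (M ⊗ X)) i j ≡ X i j
    p3 : ∀ i j → transpose (M ⊗ X) i j ≡ (M ⊗ X) i j
    p4 : ∀ i j → transpose (X ⊗ M) i j ≡ (X ⊗ M) i j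

resistance : {n : ℕ} → Matrix n → Fin n → Fin n → ℚ
resistance X i j = X i i + X j j - (X i j + X i j)

module Submission where

-- Write L for the Laplacian, X for its Moore–Penrose inverse, and (Δ f)(m) = Σ_l a_ml (f m − f l)
-- for the operator f ↦ L f. Strong connectivity gives a maximum principle for Δ: a function with
-- Δ f ≤ 0 away from s is maximal at s, strictly if Δ f < 0 there. In particular ker L consists of
-- constants, and since L (I − XL) = 0, X L = (X L)ᵀ and XL has zero row sums, XL = I − κJ with κ > 0.
-- Balancedness makes Lᵀ the Laplacian of the converse digraph, so likewise LX = I − κ′J. Hence column
-- j of X has L-image δ_j − κ′, negative off j, so x_ij < x_jj; dually x_ij < x_ii, and
-- r_ij = (x_ii − x_ij) + (x_jj − x_ij) > 0. The difference of columns j and k has L-image δ_j − δ_k,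
-- non-positive off j, so x_ij − x_ik ≤ x_jj − x_jk, which rearranges to r_ik ≤ r_ij + r_jk.

open import Defs
open import Data.Bool using (Bool; true; false; if_then_else_)
open import Data.Fin using (Fin; zero; suc; _≟_)
open import Data.List using (allFin)
open import Data.List.Membership.Propositional.Properties using (∈-allFin)
open import Data.List.Relation.Unary.All using (lookup)
open import Data.Nat using (ℕ; zero; suc)
open import Data.Product using (_×_; _,_)
open import Data.Rational using (ℚ; 0ℚ; 1ℚ; _<_; _≤_; _+_; _-_; _*_; -_)
open import Data.Rational.Base using (+-0-rawMonoid)
open import Data.Rational.Properties
  using ( ≤-refl; ≤-trans; ≤-antisym; ≤-reflexive; <⇒≤; ≰⇒>; <-irrefl; <-≤-trans; _≤?_
        ; ≤-decTotalOrder; module ≤-Reasoning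
        ; +-mono-≤; +-monoˡ-≤; +-monoʳ-≤; +-mono-<; +-monoˡ-<; neg-antimono-≤
        ; +-0-group; +-inverseʳ; +-identityˡ; +-identityʳ
        ; *-zeroˡ; *-zeroʳ; *-identityˡ; *-identityʳ; *-comm; *-assoc; *-distribˡ-+; *-distribʳ-+
        ; positive⁻¹; nonNegative⁻¹ )
open import Data.Rational.Solver using (module +-*-Solver)
open import Relation.Binary.Bundles using (DecTotalOrder)
open import Relation.Binary.Construct.Closure.ReflexiveTransitive using (Star; ε; _◅_; reverse)
open import Relation.Binary.PropositionalEquality
open import Relation.Nullary using (does; yes; no; contradiction)

open import Algebra.Definitions.RawMonoid +-0-rawMonoid using () renaming (_×_ to _×ℚ_)
open import Algebra.Properties.Group +-0-group using (x∙y⁻¹≈ε⇒x≈y)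
open import Data.List.Extrema (DecTotalOrder.totalOrder ≤-decTotalOrder) using (argmax; f[xs]≤f[argmax])

open +-*-Solver using (solve; _:=_; _:+_; _:-_; _:*_)

private
  variable
    n : ℕ

p≤q⇒0≤q-p : ∀ {p q} → p ≤ q → 0ℚ ≤ q - p
p≤q⇒0≤q-p {p} {q} p≤q = subst (_≤ q - p) (+-inverseʳ p) (+-monoˡ-≤ (- p) p≤q)

p<q⇒0<q-p : ∀ {p q} → p < q → 0ℚ < q - p
p<q⇒0<q-p {p} {q} p<q = subst (_< q - p) (+-inverseʳ p) (+-monoˡ-< (- p) p<q)

0<q-p⇒p<q : ∀ {p q} → 0ℚ < q - p → p < q
0<q-p⇒p<q {p} {q} 0<q-p = subst₂ _<_ (+-identityˡ p) (solve 2 (λ p q → (q :- p) :+ p := q) refl p q)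
                                 (+-monoˡ-< p 0<q-p)

0≤p⇒0-p≤0 : ∀ {p} → 0ℚ ≤ p → 0ℚ - p ≤ 0ℚ
0≤p⇒0-p≤0 {p} 0≤p = subst (_≤ 0ℚ) (sym (+-identityˡ (- p))) (neg-antimono-≤ 0≤p)

*-distribˡ-- : ∀ a x y → a * (x - y) ≡ a * x - a * y
*-distribˡ-- = solve 3 (λ a x y → a :* (x :- y) := a :* x :- a :* y) refl

a-x≡b-y⇒x-y≡a-b : ∀ {a b x y} → a - x ≡ b - y → x - y ≡ a - b
a-x≡b-y⇒x-y≡a-b {a} {b} {x} {y} eq = begin
  x - y
    ≡⟨ solve 4 (λ a b x y → x :- y := (a :- b) :- ((a :- x) :- (b :- y))) refl a b x y ⟩
  (a - b) - ((a - x) - (b - y)) ≡⟨ cong (λ t → (a - b) - (t - (b - y))) eq ⟩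
  (a - b) - ((b - y) - (b - y)) ≡⟨ cong (λ t → (a - b) - t) (+-inverseʳ (b - y)) ⟩
  (a - b) - 0ℚ                  ≡⟨ +-identityʳ (a - b) ⟩
  a - b                         ∎
  where open ≡-Reasoning

∑-cong : ∀ {f g : Fin n → ℚ} → (∀ i → f i ≡ g i) → ∑ n f ≡ ∑ n g
∑-cong {zero}  f≗g = refl
∑-cong {suc n} f≗g = cong₂ _+_ (f≗g zero) (∑-cong (λ i → f≗g (suc i)))

∑-zero : ∀ {f : Fin n → ℚ} → (∀ i → f i ≡ 0ℚ) → ∑ n f ≡ 0ℚ
∑-zero {zero}  f≗0 = refl
∑-zero {suc n} f≗0 = cong₂ _+_ (f≗0 zero) (∑-zero (λ i → f≗0 (suc i)))

∑-distrib-- : ∀ (f g : Fin n → ℚ) → ∑ n (λ i → f i - g i) ≡ ∑ n f - ∑ n g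
∑-distrib-- {zero}  f g = refl
∑-distrib-- {suc n} f g = begin
  (f zero - g zero) + ∑ n (λ i → f (suc i) - g (suc i))
    ≡⟨ cong ((f zero - g zero) +_) (∑-distrib-- (λ i → f (suc i)) (λ i → g (suc i))) ⟩
  (f zero - g zero) + (∑ n (λ i → f (suc i)) - ∑ n (λ i → g (suc i)))
    ≡⟨ solve 4 (λ a b c d → (a :- b) :+ (c :- d) := (a :+ c) :- (b :+ d)) refl
         (f zero) (g zero) (∑ n (λ i → f (suc i))) (∑ n (λ i → g (suc i))) ⟩
  (f zero + ∑ n (λ i → f (suc i))) - (g zero + ∑ n (λ i → g (suc i))) ∎
  where open ≡-Reasoning

*-distribˡ-∑ : ∀ c (f : Fin n → ℚ) → c * ∑ n f ≡ ∑ n (λ i → c * f i)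
*-distribˡ-∑ {zero}  c f = *-zeroʳ c
*-distribˡ-∑ {suc n} c f =
  trans (*-distribˡ-+ c (f zero) _) (cong (c * f zero +_) (*-distribˡ-∑ c (λ i → f (suc i))))

*-distribʳ-∑ : ∀ c (f : Fin n → ℚ) → ∑ n f * c ≡ ∑ n (λ i → f i * c)
*-distribʳ-∑ {zero}  c f = *-zeroˡ c
*-distribʳ-∑ {suc n} c f =
  trans (*-distribʳ-+ c (f zero) _) (cong (f zero * c +_) (*-distribʳ-∑ c (λ i → f (suc i))))

∑-distrib-+ : ∀ (f g : Fin n → ℚ) → ∑ n (λ i → f i + g i) ≡ ∑ n f + ∑ n g
∑-distrib-+ {zero}  f g = refl
∑-distrib-+ {suc n} f g =
  trans (cong (f zero + g zero +_) (∑-distrib-+ (λ i → f (suc i)) (λ i → g (suc i))))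
        (solve 4 (λ a b c d → (a :+ b) :+ (c :+ d) := (a :+ c) :+ (b :+ d)) refl
           (f zero) (g zero) (∑ n (λ i → f (suc i))) (∑ n (λ i → g (suc i))))

∑-comm : ∀ {m} (f : Fin n → Fin m → ℚ) →
         ∑ n (λ i → ∑ m (λ j → f i j)) ≡ ∑ m (λ j → ∑ n (λ i → f i j))
∑-comm {zero}  {m} f = sym (∑-zero {m} (λ _ → refl))
∑-comm {suc n} {m} f = begin
  ∑ m (f zero) + ∑ n (λ i → ∑ m (f (suc i)))
    ≡⟨ cong (∑ m (f zero) +_) (∑-comm (λ i → f (suc i))) ⟩
  ∑ m (f zero) + ∑ m (λ j → ∑ n (λ i → f (suc i) j))
    ≡⟨ sym (∑-distrib-+ (f zero) _) ⟩
  ∑ m (λ j → f zero j + ∑ n (λ i → f (suc i) j)) ∎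
  where open ≡-Reasoning

∑-nonneg : ∀ {f : Fin n → ℚ} → (∀ i → 0ℚ ≤ f i) → 0ℚ ≤ ∑ n f
∑-nonneg {zero}  0≤f = ≤-refl
∑-nonneg {suc n} 0≤f = +-mono-≤ (0≤f zero) (∑-nonneg (λ i → 0≤f (suc i)))

∑-nonpos : ∀ {f : Fin n → ℚ} → (∀ i → f i ≤ 0ℚ) → ∑ n f ≤ 0ℚ
∑-nonpos {zero}  f≤0 = ≤-refl
∑-nonpos {suc n} f≤0 = +-mono-≤ (f≤0 zero) (∑-nonpos (λ i → f≤0 (suc i)))

nonneg-term≤∑ : ∀ {f : Fin n → ℚ} → (∀ i → 0ℚ ≤ f i) → ∀ i → f i ≤ ∑ n f
nonneg-term≤∑ {suc n} {f} 0≤f zero    = begin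
  f zero                             ≡⟨ sym (+-identityʳ (f zero)) ⟩
  f zero + 0ℚ                        ≤⟨ +-monoʳ-≤ (f zero) (∑-nonneg (λ i → 0≤f (suc i))) ⟩
  f zero + ∑ n (λ i → f (suc i))     ∎
  where open ≤-Reasoning
nonneg-term≤∑ {suc n} {f} 0≤f (suc i) = begin
  f (suc i)                          ≤⟨ nonneg-term≤∑ (λ i → 0≤f (suc i)) i ⟩
  ∑ n (λ i → f (suc i))              ≡⟨ sym (+-identityˡ _) ⟩
  0ℚ + ∑ n (λ i → f (suc i))         ≤⟨ +-monoˡ-≤ _ (0≤f zero) ⟩
  f zero + ∑ n (λ i → f (suc i))     ∎
  where open ≤-Reasoning

∑-nonneg-≤0⇒≡0 : ∀ {f : Fin n → ℚ} → (∀ i → 0ℚ ≤ f i) → ∑ n f ≤ 0ℚ → ∀ i → f i ≡ 0ℚ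
∑-nonneg-≤0⇒≡0 0≤f ∑≤0 i = ≤-antisym (≤-trans (nonneg-term≤∑ 0≤f i) ∑≤0) (0≤f i)

∑-const≡1⇒0< : ∀ {c} → ∑ n (λ _ → c) ≡ 1ℚ → 0ℚ < c
∑-const≡1⇒0< {n} {c} ∑≡1 with c ≤? 0ℚ
... | no  c≰0 = ≰⇒> c≰0
... | yes c≤0 = contradiction (<-≤-trans (positive⁻¹ 1ℚ) 1≤0) (<-irrefl refl)
  where
  1≤0 : 1ℚ ≤ 0ℚ
  1≤0 = subst (_≤ 0ℚ) ∑≡1 (∑-nonpos {n} (λ _ → c≤0))

δ : Fin n → Fin n → ℚ
δ i j = if does (i ≟ j) then 1ℚ else 0ℚ

δ-sym : ∀ (i j : Fin n) → δ i j ≡ δ j i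
δ-sym zero    zero    = refl
δ-sym zero    (suc j) = refl
δ-sym (suc i) zero    = refl
δ-sym (suc i) (suc j) = δ-sym i j

δ-≢ : ∀ {i j : Fin n} → i ≢ j → δ i j ≡ 0ℚ
δ-≢ {i = i} {j} i≢j with i ≟ j
... | yes i≡j = contradiction i≡j i≢j
... | no  _   = refl

δ-nonneg : ∀ (i j : Fin n) → 0ℚ ≤ δ i j
δ-nonneg i j with does (i ≟ j)
... | true  = nonNegative⁻¹ 1ℚ
... | false = ≤-refl

∑-δˡ : ∀ (i : Fin n) (f : Fin n → ℚ) → ∑ n (λ j → δ i j * f j) ≡ f i
∑-δˡ {suc n} zero    f = begin
  1ℚ * f zero + ∑ n (λ j → 0ℚ * f (suc j))
    ≡⟨ cong₂ _+_ (*-identityˡ (f zero)) (∑-zero (λ j → *-zeroˡ (f (suc j)))) ⟩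
  f zero + 0ℚ
    ≡⟨ +-identityʳ (f zero) ⟩
  f zero ∎
  where open ≡-Reasoning
∑-δˡ {suc n} (suc i) f = begin
  0ℚ * f zero + ∑ n (λ j → δ i j * f (suc j))
    ≡⟨ cong₂ _+_ (*-zeroˡ (f zero)) (∑-δˡ i (λ j → f (suc j))) ⟩
  0ℚ + f (suc i)
    ≡⟨ +-identityˡ (f (suc i)) ⟩
  f (suc i) ∎
  where open ≡-Reasoning

∑-δʳ : ∀ (j : Fin n) (f : Fin n → ℚ) → ∑ n (λ i → f i * δ i j) ≡ f j
∑-δʳ j f = trans (∑-cong (λ i → trans (*-comm (f i) (δ i j)) (cong (_* f i) (δ-sym i j)))) (∑-δˡ j f)

Δ : Digraph n → (Fin n → ℚ) → Fin n → ℚ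
Δ {n} H f m = ∑ n (λ l → adjMatrix H m l * (f m - f l))

Δ-const : ∀ (H : Digraph n) c m → Δ H (λ _ → c) m ≡ 0ℚ
Δ-const H c m = ∑-zero (λ l → trans (cong (adjMatrix H m l *_) (+-inverseʳ c)) (*-zeroʳ (adjMatrix H m l)))

module _ (H : Digraph n) (f : Fin n → ℚ) where

  IsMaxAt : Fin n → Set
  IsMaxAt v = ∀ k → f k ≤ f v

  Δ-term-nonneg-at-max : ∀ {v} → IsMaxAt v → ∀ l → 0ℚ ≤ adjMatrix H v l * (f v - f l)
  Δ-term-nonneg-at-max {v} isMax l with H v l
  ... | true  = subst (0ℚ ≤_) (sym (*-identityˡ _)) (p≤q⇒0≤q-p (isMax l))
  ... | false = ≤-reflexive (sym (*-zeroˡ (f v - f l)))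

  Δ-nonneg-at-max : ∀ {v} → IsMaxAt v → 0ℚ ≤ Δ H f v
  Δ-nonneg-at-max isMax = ∑-nonneg (Δ-term-nonneg-at-max isMax)

  max-spreads-along-edge : ∀ {v w} → IsMaxAt v → Δ H f v ≤ 0ℚ → Edge H v w → IsMaxAt w
  max-spreads-along-edge {v} {w} isMax Δ≤0 vw = subst (λ x → ∀ k → f k ≤ x) (sym fw≡fv) isMax
    where
    term-vw≡0 : adjMatrix H v w * (f v - f w) ≡ 0ℚ
    term-vw≡0 = ∑-nonneg-≤0⇒≡0 (Δ-term-nonneg-at-max isMax) Δ≤0 w
    fw≡fv : f w ≡ f v
    fw≡fv = sym (x∙y⁻¹≈ε⇒x≈y (f v) (f w) (begin
      f v - f w                         ≡⟨ sym (*-identityˡ (f v - f w)) ⟩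
      1ℚ * (f v - f w)                  ≡⟨ cong (λ b → (if b then 1ℚ else 0ℚ) * (f v - f w)) (sym vw) ⟩
      adjMatrix H v w * (f v - f w)     ≡⟨ term-vw≡0 ⟩
      0ℚ                                ∎))
      where open ≡-Reasoning

  max-propagates-along-path : ∀ {s v} → (∀ m → m ≢ s → Δ H f m ≤ 0ℚ) →
                              IsMaxAt v → Star (Edge H) v s → IsMaxAt s
  max-propagates-along-path Δ≤0 isMax ε = isMax
  max-propagates-along-path {s} {v} Δ≤0 isMax (vw ◅ ws) with v ≟ s
  ... | yes refl = isMax
  ... | no  v≢s  = max-propagates-along-path Δ≤0 (max-spreads-along-edge isMax (Δ≤0 v v≢s) vw) ws

  maximum-principle : StronglyConnected H → ∀ {s} → (∀ m → m ≢ s → Δ H f m ≤ 0ℚ) → IsMaxAt s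
  maximum-principle sc {s} Δ≤0 =
    max-propagates-along-path Δ≤0 global-max (sc (argmax f s (allFin n)) s)
    where
    global-max : IsMaxAt (argmax f s (allFin n))
    global-max k = lookup (f[xs]≤f[argmax] {f = f} s (allFin n)) (∈-allFin k)

  strict-maximum-principle : StronglyConnected H → ∀ {s} → (∀ m → m ≢ s → Δ H f m < 0ℚ) →
                             ∀ k → k ≢ s → f k < f s
  strict-maximum-principle sc {s} Δ<0 k k≢s with f s ≤? f k
  ... | no  fs≰fk = ≰⇒> fs≰fk
  ... | yes fs≤fk = contradiction (<-≤-trans (Δ<0 k k≢s) (Δ-nonneg-at-max max-at-k)) (<-irrefl refl)
    where
    max-at-k : IsMaxAt k
    max-at-k l = ≤-trans (maximum-principle sc (λ m m≢s → <⇒≤ (Δ<0 m m≢s)) l) fs≤fk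

  Δ≡0⇒constant : StronglyConnected H → (∀ m → Δ H f m ≡ 0ℚ) → ∀ a b → f a ≡ f b
  Δ≡0⇒constant sc Δ≡0 a b = ≤-antisym (max-at b a) (max-at a b)
    where
    max-at : ∀ s → IsMaxAt s
    max-at s = maximum-principle sc (λ m _ → ≤-reflexive (Δ≡0 m))

⊗-assoc : ∀ (M N K : Matrix n) i j → (M ⊗ (N ⊗ K)) i j ≡ ((M ⊗ N) ⊗ K) i j
⊗-assoc {n} M N K i j = begin
  ∑ n (λ k → M i k * ∑ n (λ l → N k l * K l j))
    ≡⟨ ∑-cong (λ k → *-distribˡ-∑ {n} (M i k) _) ⟩
  ∑ n (λ k → ∑ n (λ l → M i k * (N k l * K l j)))
    ≡⟨ ∑-comm {n} {n} _ ⟩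
  ∑ n (λ l → ∑ n (λ k → M i k * (N k l * K l j)))
    ≡⟨ ∑-cong (λ l → ∑-cong (λ k → sym (*-assoc (M i k) (N k l) (K l j)))) ⟩
  ∑ n (λ l → ∑ n (λ k → M i k * N k l * K l j))
    ≡⟨ ∑-cong (λ l → sym (*-distribʳ-∑ {n} (K l j) _)) ⟩
  ∑ n (λ l → (M ⊗ N) i l * K l j) ∎
  where open ≡-Reasoning

⊗-transpose : ∀ (M N : Matrix n) i j → (transpose N ⊗ transpose M) i j ≡ (M ⊗ N) j i
⊗-transpose M N i j = ∑-cong (λ k → *-comm (N k i) (M j k))

⊗-transpose₃ : ∀ (M N K : Matrix n) i j →
               (transpose K ⊗ (transpose N ⊗ transpose M)) i j ≡ (M ⊗ (N ⊗ K)) j i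
⊗-transpose₃ M N K i j = begin
  (transpose K ⊗ (transpose N ⊗ transpose M)) i j
    ≡⟨ ∑-cong (λ k → cong (K k i *_) (⊗-transpose M N k j)) ⟩
  (transpose K ⊗ transpose (M ⊗ N)) i j
    ≡⟨ ⊗-transpose (M ⊗ N) K i j ⟩
  ((M ⊗ N) ⊗ K) j i
    ≡⟨ sym (⊗-assoc M N K j i) ⟩
  (M ⊗ (N ⊗ K)) j i ∎
  where open ≡-Reasoning

IsMoorePenroseInverse-transpose : ∀ {M X : Matrix n} → IsMoorePenroseInverse M X →
                                  IsMoorePenroseInverse (transpose M) (transpose X)
IsMoorePenroseInverse-transpose {M = M} {X} mp = record
  { p1 = λ i j → trans (⊗-transpose₃ M X M i j) (p1 j i)
  ; p2 = λ i j → trans (⊗-transpose₃ X M X i j) (p2 j i)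
  ; p3 = λ i j → trans (⊗-transpose X M j i) (trans (sym (p4 i j)) (sym (⊗-transpose X M i j)))
  ; p4 = λ i j → trans (⊗-transpose M X j i) (trans (sym (p3 i j)) (sym (⊗-transpose M X i j)))
  }
  where open IsMoorePenroseInverse mp

converse : Digraph n → Digraph n
converse H i j = H j i

converse-stronglyConnected : ∀ {H : Digraph n} → StronglyConnected H → StronglyConnected (converse H)
converse-stronglyConnected sc i j = reverse (λ e → e) (sc j i)

IsLaplacianOf : Matrix n → Digraph n → Set
IsLaplacianOf {n} L H = ∀ f m → ∑ n (λ l → L m l * f l) ≡ Δ H f m

Δ-expand : ∀ (H : Digraph n) f m →
           Δ H f m ≡ ∑ n (adjMatrix H m) * f m - ∑ n (λ l → adjMatrix H m l * f l)
Δ-expand {n} H f m = begin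
  ∑ n (λ l → adjMatrix H m l * (f m - f l))
    ≡⟨ ∑-cong (λ l → *-distribˡ-- (adjMatrix H m l) (f m) (f l)) ⟩
  ∑ n (λ l → adjMatrix H m l * f m - adjMatrix H m l * f l)
    ≡⟨ ∑-distrib-- {n} _ _ ⟩
  ∑ n (λ l → adjMatrix H m l * f m) - ∑ n (λ l → adjMatrix H m l * f l)
    ≡⟨ cong (_- ∑ n (λ l → adjMatrix H m l * f l)) (sym (*-distribʳ-∑ (f m) (adjMatrix H m))) ⟩
  ∑ n (adjMatrix H m) * f m - ∑ n (λ l → adjMatrix H m l * f l) ∎
  where open ≡-Reasoning

rowSumDiag-δ : ∀ (A : Matrix n) i j → rowSumDiag A i j ≡ δ i j * ∑ n (A i)
rowSumDiag-δ {n} A i j with does (i ≟ j)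
... | true  = sym (*-identityˡ (∑ n (A i)))
... | false = sym (*-zeroˡ (∑ n (A i)))

∑-indicator : ∀ (g : Fin n → Bool) → ∑ n (λ k → if g k then 1ℚ else 0ℚ) ≡ count n g ×ℚ 1ℚ
∑-indicator {zero}  g = refl
∑-indicator {suc n} g with g zero
... | true  = cong (1ℚ +_) (∑-indicator (λ k → g (suc k)))
... | false = trans (+-identityˡ (∑ n (λ k → if g (suc k) then 1ℚ else 0ℚ)))
                    (∑-indicator (λ k → g (suc k)))

balanced-degree : ∀ {G : Digraph n} → Balanced G → ∀ m →
                  ∑ n (adjMatrix G m) ≡ ∑ n (λ l → adjMatrix G l m)
balanced-degree {G = G} bal m =
  trans (∑-indicator (G m)) (trans (cong (_×ℚ 1ℚ) (sym (bal m))) (sym (∑-indicator (λ l → G l m))))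

laplacian-isLaplacianOf : ∀ (G : Digraph n) → IsLaplacianOf (laplacian G) G
laplacian-isLaplacianOf {n} G f m = begin
  ∑ n (λ l → laplacian G m l * f l)
    ≡⟨ ∑-cong (λ l → cong (λ d → (d - A m l) * f l) (rowSumDiag-δ A m l)) ⟩
  ∑ n (λ l → (δ m l * S m - A m l) * f l)
    ≡⟨ ∑-cong (λ l → solve 4 (λ d s a x → (d :* s :- a) :* x := d :* (s :* x) :- a :* x) refl
                       (δ m l) (S m) (A m l) (f l)) ⟩
  ∑ n (λ l → δ m l * (S m * f l) - A m l * f l)
    ≡⟨ ∑-distrib-- {n} _ _ ⟩
  ∑ n (λ l → δ m l * (S m * f l)) - ∑ n (λ l → A m l * f l)
    ≡⟨ cong (_- ∑ n (λ l → A m l * f l)) (∑-δˡ m (λ l → S m * f l)) ⟩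
  S m * f m - ∑ n (λ l → A m l * f l)
    ≡⟨ sym (Δ-expand G f m) ⟩
  Δ G f m ∎
  where
  open ≡-Reasoning
  A = adjMatrix G
  S : Fin n → ℚ
  S i = ∑ n (A i)

balanced⇒transpose-laplacian-isLaplacianOf :
  ∀ {G : Digraph n} → Balanced G → IsLaplacianOf (transpose (laplacian G)) (converse G)
balanced⇒transpose-laplacian-isLaplacianOf {n} {G} bal f m = begin
  ∑ n (λ l → laplacian G l m * f l)
    ≡⟨ ∑-cong (λ l → cong (λ d → (d - A l m) * f l) (rowSumDiag-δ A l m)) ⟩
  ∑ n (λ l → (δ l m * S l - A l m) * f l)
    ≡⟨ ∑-cong (λ l → solve 4 (λ d s a x → (d :* s :- a) :* x := (s :* x) :* d :- a :* x) refl
                       (δ l m) (S l) (A l m) (f l)) ⟩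
  ∑ n (λ l → (S l * f l) * δ l m - A l m * f l)
    ≡⟨ ∑-distrib-- {n} _ _ ⟩
  ∑ n (λ l → (S l * f l) * δ l m) - ∑ n (λ l → A l m * f l)
    ≡⟨ cong (_- ∑ n (λ l → A l m * f l)) (∑-δʳ m (λ l → S l * f l)) ⟩
  S m * f m - ∑ n (λ l → A l m * f l)
    ≡⟨ cong (λ s → s * f m - ∑ n (λ l → A l m * f l)) (balanced-degree bal m) ⟩
  ∑ n (λ l → A l m) * f m - ∑ n (λ l → A l m * f l)
    ≡⟨ sym (Δ-expand (converse G) f m) ⟩
  Δ (converse G) f m ∎
  where
  open ≡-Reasoning
  A = adjMatrix G
  S : Fin n → ℚ
  S i = ∑ n (A i)

module XLProduct {H : Digraph n} (sc : StronglyConnected H) {L X : Matrix n}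
                    (L-lap : IsLaplacianOf L H) (mp : IsMoorePenroseInverse L X) where

  open IsMoorePenroseInverse mp

  L-rowSum≡0 : ∀ i → ∑ n (L i) ≡ 0ℚ
  L-rowSum≡0 i = begin
    ∑ n (L i)                     ≡⟨ ∑-cong (λ l → sym (*-identityʳ (L i l))) ⟩
    ∑ n (λ l → L i l * 1ℚ)        ≡⟨ L-lap (λ _ → 1ℚ) i ⟩
    Δ H (λ _ → 1ℚ) i              ≡⟨ Δ-const H 1ℚ i ⟩
    0ℚ                            ∎
    where open ≡-Reasoning

  XL-rowSum≡0 : ∀ a → ∑ n ((X ⊗ L) a) ≡ 0ℚ
  XL-rowSum≡0 a = begin
    ∑ n (λ b → ∑ n (λ l → X a l * L l b))
      ≡⟨ ∑-comm {n} {n} _ ⟩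
    ∑ n (λ l → ∑ n (λ b → X a l * L l b))
      ≡⟨ ∑-cong (λ l → sym (*-distribˡ-∑ (X a l) (L l))) ⟩
    ∑ n (λ l → X a l * ∑ n (L l))
      ≡⟨ ∑-zero (λ l → trans (cong (X a l *_) (L-rowSum≡0 l)) (*-zeroʳ (X a l))) ⟩
    0ℚ ∎
    where open ≡-Reasoning

  -- L (I - XL) = L - LXL = 0, so every column of I - XL is in the kernel of Δ H.
  I-XL-columnConstant : ∀ m a b → δ a m - (X ⊗ L) a m ≡ δ b m - (X ⊗ L) b m
  I-XL-columnConstant m = Δ≡0⇒constant H column sc Δ-column≡0
    where
    open ≡-Reasoning
    column : Fin n → ℚ
    column k = δ k m - (X ⊗ L) k m
    Δ-column≡0 : ∀ i → Δ H column i ≡ 0ℚ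
    Δ-column≡0 i = begin
      Δ H column i
        ≡⟨ sym (L-lap column i) ⟩
      ∑ n (λ k → L i k * (δ k m - (X ⊗ L) k m))
        ≡⟨ ∑-cong (λ k → *-distribˡ-- (L i k) (δ k m) ((X ⊗ L) k m)) ⟩
      ∑ n (λ k → L i k * δ k m - L i k * (X ⊗ L) k m)
        ≡⟨ ∑-distrib-- {n} _ _ ⟩
      ∑ n (λ k → L i k * δ k m) - (L ⊗ (X ⊗ L)) i m
        ≡⟨ cong₂ _-_ (∑-δʳ m (L i)) (p1 i m) ⟩
      L i m - L i m
        ≡⟨ +-inverseʳ (L i m) ⟩
      0ℚ ∎

  I-XL-rowConstant : ∀ a b → δ a b - (X ⊗ L) a b ≡ δ a a - (X ⊗ L) a a
  I-XL-rowConstant a b = trans (cong₂ _-_ (δ-sym a b) (sym (p4 a b))) (I-XL-columnConstant a b a)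

  XL<I : ∀ a b → (X ⊗ L) a b < δ a b
  XL<I a b = 0<q-p⇒p<q (subst (0ℚ <_) (sym (I-XL-rowConstant a b)) (∑-const≡1⇒0< {n} rowSum≡1))
    where
    open ≡-Reasoning
    rowSum≡1 : ∑ n (λ _ → δ a a - (X ⊗ L) a a) ≡ 1ℚ
    rowSum≡1 = begin
      ∑ n (λ _ → δ a a - (X ⊗ L) a a)         ≡⟨ ∑-cong (λ b → sym (I-XL-rowConstant a b)) ⟩
      ∑ n (λ b → δ a b - (X ⊗ L) a b)         ≡⟨ ∑-distrib-- {n} _ _ ⟩
      ∑ n (δ a) - ∑ n ((X ⊗ L) a)             ≡⟨ cong₂ _-_ δ-rowSum (XL-rowSum≡0 a) ⟩
      1ℚ - 0ℚ                                 ≡⟨⟩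
      1ℚ                                      ∎
      where
      δ-rowSum : ∑ n (δ a) ≡ 1ℚ
      δ-rowSum = trans (∑-cong (λ b → sym (*-identityʳ (δ a b)))) (∑-δˡ a (λ _ → 1ℚ))

module ColumnDominance {H H′ : Digraph n} (sc : StronglyConnected H) (sc′ : StronglyConnected H′)
                       {L X : Matrix n} (L-lap : IsLaplacianOf L H) (Lᵀ-lap : IsLaplacianOf (transpose L) H′)
                       (mp : IsMoorePenroseInverse L X) where

  -- Applied to Lᵀ and Xᵀ, whose product XᵀLᵀ is (LX)ᵀ.
  open XLProduct sc′ Lᵀ-lap (IsMoorePenroseInverse-transpose mp)

  Δ-column : ∀ j m → Δ H (λ l → X l j) m ≡ (transpose X ⊗ transpose L) j m
  Δ-column j m = trans (sym (L-lap (λ l → X l j) m)) (sym (⊗-transpose L X j m))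

  column-max : ∀ i j → i ≢ j → X i j < X j j
  column-max i j i≢j = strict-maximum-principle H (λ l → X l j) sc Δ<0 i i≢j
    where
    Δ<0 : ∀ m → m ≢ j → Δ H (λ l → X l j) m < 0ℚ
    Δ<0 m m≢j = subst₂ _<_ (sym (Δ-column j m)) (δ-≢ (≢-sym m≢j)) (XL<I j m)

  column-difference-max : ∀ i j k → X k j - X k i ≤ X j j - X j i
  column-difference-max i j = maximum-principle H difference sc Δ≤0
    where
    difference : Fin n → ℚ
    difference l = X l j - X l i
    Δ≤0 : ∀ m → m ≢ j → Δ H difference m ≤ 0ℚ
    Δ≤0 m m≢j = subst (_≤ 0ℚ) (sym Δ-difference) (0≤p⇒0-p≤0 (δ-nonneg i m))
      where
      open ≡-Reasoning
      Δ-difference : Δ H difference m ≡ 0ℚ - δ i m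
      Δ-difference = begin
        Δ H difference m
          ≡⟨ sym (L-lap difference m) ⟩
        ∑ n (λ l → L m l * (X l j - X l i))
          ≡⟨ ∑-cong (λ l → *-distribˡ-- (L m l) (X l j) (X l i)) ⟩
        ∑ n (λ l → L m l * X l j - L m l * X l i)
          ≡⟨ ∑-distrib-- {n} _ _ ⟩
        (L ⊗ X) m j - (L ⊗ X) m i
          ≡⟨ cong₂ _-_ (sym (⊗-transpose L X j m)) (sym (⊗-transpose L X i m)) ⟩
        (transpose X ⊗ transpose L) j m - (transpose X ⊗ transpose L) i m
          ≡⟨ a-x≡b-y⇒x-y≡a-b {δ j m} {δ i m} (I-XL-columnConstant m j i) ⟩
        δ j m - δ i m
          ≡⟨ cong (_- δ i m) (δ-≢ (≢-sym m≢j)) ⟩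
        0ℚ - δ i m ∎

resistance-pos : ∀ (X : Matrix n) {i j} → X i j < X i i → X i j < X j j → 0ℚ < resistance X i j
resistance-pos X {i} {j} row-max col-max =
  subst (0ℚ <_) (sym split) (+-mono-< (p<q⇒0<q-p row-max) (p<q⇒0<q-p col-max))
  where
  split : resistance X i j ≡ (X i i - X i j) + (X j j - X i j)
  split = solve 3 (λ a b c → a :+ b :- (c :+ c) := (a :- c) :+ (b :- c)) refl (X i i) (X j j) (X i j)

resistance-triangle : ∀ (X : Matrix n) i j k → X i j - X i k ≤ X j j - X j k →
                      resistance X i k ≤ resistance X i j + resistance X j k
resistance-triangle X i j k column-diff = begin
  resistance X i k                      ≡⟨ sym (+-identityʳ (resistance X i k)) ⟩
  resistance X i k + 0ℚ                 ≤⟨ +-monoʳ-≤ (resistance X i k) (+-mono-≤ 0≤t 0≤t) ⟩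
  resistance X i k + (t + t)            ≡⟨ regroup ⟩
  resistance X i j + resistance X j k   ∎
  where
  open ≤-Reasoning
  t : ℚ
  t = (X j j - X j k) - (X i j - X i k)
  0≤t : 0ℚ ≤ t
  0≤t = p≤q⇒0≤q-p column-diff
  regroup : resistance X i k + (t + t) ≡ resistance X i j + resistance X j k
  regroup = solve 6 (λ ii jj kk ij jk ik →
              (ii :+ kk :- (ik :+ ik)) :+ (((jj :- jk) :- (ij :- ik)) :+ ((jj :- jk) :- (ij :- ik)))
                := (ii :+ jj :- (ij :+ ij)) :+ (jj :+ kk :- (jk :+ jk)))
              refl (X i i) (X j j) (X k k) (X i j) (X j k) (X i k)

theorem3p3 : (n : ℕ) (G : Digraph n) → Simple G → StronglyConnected G → Balanced G →
    (X : Matrix n) → IsMoorePenroseInverse (laplacian G) X →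
    (∀ (i j : Fin n) → i ≢ j → 0ℚ < resistance X i j) ×
    (∀ (i j k : Fin n) → resistance X i k ≤ resistance X i j + resistance X j k)
theorem3p3 n G _ sc bal X mp = positive , triangle
  where
  L-lap  = laplacian-isLaplacianOf G
  Lᵀ-lap = balanced⇒transpose-laplacian-isLaplacianOf bal
  scᵀ    = converse-stronglyConnected sc
  open ColumnDominance sc scᵀ L-lap Lᵀ-lap mp
  module Rows = ColumnDominance scᵀ sc Lᵀ-lap L-lap (IsMoorePenroseInverse-transpose mp)

  positive : ∀ i j → i ≢ j → 0ℚ < resistance X i j
  positive i j i≢j = resistance-pos X (Rows.column-max j i (≢-sym i≢j)) (column-max i j i≢j)

  triangle : ∀ i j k → resistance X i k ≤ resistance X i j + resistance X j k
  triangle i j k = resistance-triangle X i j k (column-difference-max k j i)
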